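{- If $G$ is a thrifty connected graph with diameter $d$, then $c_r(G)=2^d$.
   Context: A pebbling distribution assigns to each vertex a non-negative integer number of pebbles; a rooted distribution fixes a root $r$. A pebbling step $[a,b]$, for adjacent $a,b$, removes two pebbles from $a$ and adds one to $b$; it is greedy if $d(a,r)>d(b,r)$ ($d$ = graph distance). A rooted distribution is $r$-solvable if some sequence of pebbling steps (a solution) ends with at least one pebble on $r$; it is $r$-critical if it is $r$-solvable but removing any single pebble makes it not $r$-solvable; it is greedy if it has a solution using only greedy steps. $c_r(G)$ is the largest size of an $r$-critical rooted distribution on $G$ over all roots $r$; an $r$-ceiling distribution is an $r$-critical rooted distribution (any root) with exactly $c_r(G)$ pebbles. $G$ is thrifty if every $r$-ceiling distribution on $G$ is greedy. -}

module Defs where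

open import Data.Nat using (ℕ; zero; suc; _+_; _∸_; _≤_; _<_)
open import Data.Fin using (Fin; _≟_)
open import Data.Bool using (Bool; T; if_then_else_)
open import Data.Vec using (sum; tabulate)
open import Data.Product using (Σ; ∃; _×_; _,_)
open import Relation.Nullary using (¬_; does)
open import Relation.Binary.PropositionalEquality using (_≡_; _≢_)

record Graph : Set where
  field
    n     : ℕ
    adj   : Fin n → Fin n → Bool
    sym   : ∀ a b → T (adj a b) → T (adj b a)
    irrefl : ∀ a → ¬ T (adj a a)

module _ (G : Graph) where
  open Graph G

  Vertex : Set
  Vertex = Fin n

  Adj : Vertex → Vertex → Set
  Adj a b = T (adj a b)

  data Walk : Vertex → Vertex → ℕ → Set where
    here : ∀ {a} → Walk a a zero
    step : ∀ {a b c k} → Adj a b → Walk b c k → Walk a c (suc k)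

  Connected : Set
  Connected = ∀ a b → ∃ λ k → Walk a b k

  Dist : Vertex → Vertex → ℕ → Set
  Dist a b k = Walk a b k × (∀ j → Walk a b j → k ≤ j)

  Diameter : ℕ → Set
  Diameter d = (∃ λ a → ∃ λ b → Dist a b d)
             × (∀ a b k → Dist a b k → k ≤ d)

  Distribution : Set
  Distribution = Vertex → ℕ

  size : Distribution → ℕ
  size D = sum (tabulate D)

  PStep : Distribution → Vertex → Vertex → Distribution → Set
  PStep D a b D' = Adj a b × 2 ≤ D a × D' a + 2 ≡ D a × D' b ≡ suc (D b)
                 × (∀ x → x ≢ a → x ≢ b → D' x ≡ D x)

  GreedyPair : Vertex → Vertex → Vertex → Set
  GreedyPair r a b = ∃ λ ka → ∃ λ kb → Dist a r ka × Dist b r kb × kb < ka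

  data Reach : Distribution → Distribution → Set where
    done : ∀ {D} → Reach D D
    move : ∀ {D D' D''} a b → PStep D a b D' → Reach D' D'' → Reach D D''

  data GReach (r : Vertex) : Distribution → Distribution → Set where
    done : ∀ {D} → GReach r D D
    move : ∀ {D D' D''} a b → GreedyPair r a b → PStep D a b D'
         → GReach r D' D'' → GReach r D D''

  Solvable : Vertex → Distribution → Set
  Solvable r D = ∃ λ D' → Reach D D' × 1 ≤ D' r

  Greedy : Vertex → Distribution → Set
  Greedy r D = ∃ λ D' → GReach r D D' × 1 ≤ D' r

  removeOne : Distribution → Vertex → Distribution
  removeOne D v x = if does (x ≟ v) then D x ∸ 1 else D x

  Critical : Vertex → Distribution → Set
  Critical r D = Solvable r D × (∀ v → 1 ≤ D v → ¬ Solvable r (removeOne D v))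

  IsCr : ℕ → Set
  IsCr m = (∃ λ r → ∃ λ D → Critical r D × size D ≡ m)
         × (∀ r D → Critical r D → size D ≤ m)

  Thrifty : Set
  Thrifty = ∀ m → IsCr m → ∀ r D → Critical r D → size D ≡ m → Greedy r D

module Submission where

-- Weight a pebble on x by 2^(d - dist(x,r)). A pebbling step never increases
-- the total weight and a pebble on r weighs 2^d, so 2^d pebbles at distance d
-- from r are r-critical. Conversely, read a greedy solution backwards, keeping
-- only the pebbles it needs: undoing a greedy step does not increase their
-- weight, so they weigh at most as much as one pebble on r, i.e. at most 2^d,
-- and a critical distribution consists exactly of such needed pebbles. Critical
-- distributions have at most 2^d pebbles per vertex, so a ceiling distribution
-- exists; it is greedy by thriftiness, which bounds every critical size by 2^d.

open import Defs
open import Data.Nat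
  using (ℕ; zero; suc; pred; _+_; _*_; _∸_; _^_; _≤_; _<_; z≤n; s≤s; s≤s⁻¹; _≤?_; >-nonZero)
open import Data.Nat.Properties
  using ( ≤-refl; ≤-trans; ≤-reflexive; ≤-antisym; ≤⇒≯; ≮⇒≥; ≰⇒>; <⇒≤; m<1+n⇒m<n∨m≡n
        ; +-identityʳ; +-suc; +-comm; +-mono-≤; +-monoˡ-≤; +-monoʳ-≤; +-cancelʳ-≤
        ; +-commutativeSemigroup; m≤m+n; m≤n+m; *-identityˡ; *-identityʳ; *-suc; *-distribʳ-+
        ; *-monoˡ-≤; *-monoʳ-≤; m∸n+n≡m; m∸n≤m; n∸n≡0; ∸-monoˡ-≤; ∸-monoʳ-≤; ∸-monoʳ-<
        ; ^-monoʳ-≤; m^n>0; n≤0⇒n≡0; suc-pred; module ≤-Reasoning )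
open import Algebra.Properties.CommutativeSemigroup +-commutativeSemigroup using (interchange)
open import Data.Fin using (Fin; _≟_) renaming (zero to fz; suc to fs)
open import Data.Fin.Properties using (any?)
open import Data.Vec using (sum; tabulate)
open import Data.Vec.Functional using (updateAt)
open import Data.Vec.Functional.Properties using (updateAt-updates; updateAt-minimal)
open import Data.Bool using (true; false; if_then_else_)
open import Data.Product using (∃; ∃-syntax; _×_; _,_; proj₁; proj₂)
open import Data.Sum using (inj₁; inj₂)
open import Data.Empty using (⊥-elim)
open import Function using (_∘_)
open import Relation.Nullary using (¬_; Dec; yes; no; does)
open import Relation.Nullary.Decidable using (T?; _×-dec_; dec-true; decidable-stable)
open import Relation.Unary using (Decidable)
open import Relation.Binary.PropositionalEquality

private variable
  n k : ℕ
  a b x : Fin n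
  X X' Y Y' : Fin n → ℕ

∑ : (Fin n → ℕ) → ℕ
∑ f = sum (tabulate f)

infix 4 _⊑_
_⊑_ : (Fin n → ℕ) → (Fin n → ℕ) → Set
X ⊑ Y = ∀ x → X x ≤ Y x

∑-cong : {f g : Fin n → ℕ} → (∀ x → f x ≡ g x) → ∑ f ≡ ∑ g
∑-cong {zero}            _   = refl
∑-cong {suc n} {f} {g} f≗g = cong₂ _+_ (f≗g fz) (∑-cong {f = f ∘ fs} {g ∘ fs} (f≗g ∘ fs))

∑-mono-≤ : {f g : Fin n → ℕ} → f ⊑ g → ∑ f ≤ ∑ g
∑-mono-≤ {zero}            _   = z≤n
∑-mono-≤ {suc n} {f} {g} f⊑g = +-mono-≤ (f⊑g fz) (∑-mono-≤ {f = f ∘ fs} {g ∘ fs} (f⊑g ∘ fs))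

∑-distrib-+ : (f g : Fin n → ℕ) → ∑ (λ x → f x + g x) ≡ ∑ f + ∑ g
∑-distrib-+ {zero}  f g = refl
∑-distrib-+ {suc n} f g = trans (cong (f fz + g fz +_) (∑-distrib-+ (f ∘ fs) (g ∘ fs)))
                                (interchange (f fz) (g fz) (∑ (f ∘ fs)) (∑ (g ∘ fs)))

∑-zero : ∑ {n} (λ _ → 0) ≡ 0
∑-zero {zero}  = refl
∑-zero {suc n} = ∑-zero {n}

pebblesAt : Fin n → ℕ → Fin n → ℕ
pebblesAt a c x = if does (x ≟ a) then c else 0

pebblesAt-here : ∀ (a : Fin n) c → pebblesAt a c a ≡ c
pebblesAt-here a c = cong (if_then c else 0) (dec-true (a ≟ a) refl)

pebblesAt-support : ∀ (a : Fin n) c x → 1 ≤ pebblesAt a c x → x ≡ a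
pebblesAt-support a c x 1≤ with x ≟ a
... | yes x≡a = x≡a
pebblesAt-support a c x () | no _

pebblesAt-⊑ : ∀ (a : Fin n) {c} → c ≤ X a → pebblesAt a c ⊑ X
pebblesAt-⊑ a c≤ x with x ≟ a
... | yes refl = c≤
... | no _     = z≤n

∑-pebblesAt : ∀ (a : Fin n) c → ∑ (pebblesAt a c) ≡ c
∑-pebblesAt {suc n} fz     c = trans (cong (c +_) (∑-zero {n})) (+-identityʳ c)
∑-pebblesAt {suc n} (fs a) c = ∑-pebblesAt a c

updateAt₂ : (Fin n → ℕ) → Fin n → (ℕ → ℕ) → Fin n → (ℕ → ℕ) → Fin n → ℕ
updateAt₂ X a f b g = updateAt (updateAt X a f) b g

module _ (X : Fin n → ℕ) {a b : Fin n} (f g : ℕ → ℕ) (a≢b : a ≢ b) where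

  updateAt₂-first : updateAt₂ X a f b g a ≡ f (X a)
  updateAt₂-first = trans (updateAt-minimal a b (updateAt X a f) a≢b) (updateAt-updates a X)

  updateAt₂-second : updateAt₂ X a f b g b ≡ g (X b)
  updateAt₂-second = trans (updateAt-updates b (updateAt X a f))
                           (cong g (updateAt-minimal b a X (a≢b ∘ sym)))

  updateAt₂-other : x ≢ a → x ≢ b → updateAt₂ X a f b g x ≡ X x
  updateAt₂-other {x} x≢a x≢b = trans (updateAt-minimal x b (updateAt X a f) x≢b)
                                      (updateAt-minimal x a X x≢a)

-- The arithmetic part of a pebbling step [a,b]; `PStep G X a b X'` unfolds to
-- `Adj G a b × 2 ≤ X a × Moves X a b X'`.
Moves : (Fin n → ℕ) → Fin n → Fin n → (Fin n → ℕ) → Set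
Moves X a b X' = X' a + 2 ≡ X a × X' b ≡ suc (X b) × (∀ x → x ≢ a → x ≢ b → X' x ≡ X x)

Moves-mono-⊑ : Moves X a b X' → Moves Y a b Y' → X ⊑ Y → X' ⊑ Y'
Moves-mono-⊑ {a = a} {b = b} (xa , xb , xo) (ya , yb , yo) X⊑Y x with x ≟ a | x ≟ b
... | yes refl | _        = +-cancelʳ-≤ 2 _ _ (subst₂ _≤_ (sym xa) (sym ya) (X⊑Y x))
... | no _     | yes refl = subst₂ _≤_ (sym xb) (sym yb) (s≤s (X⊑Y x))
... | no x≢a   | no x≢b   = subst₂ _≤_ (sym (xo x x≢a x≢b)) (sym (yo x x≢a x≢b)) (X⊑Y x)

Moves-cancel-⊑ : Moves X a b X' → Moves Y a b Y' → X' ⊑ Y' → X ⊑ Y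
Moves-cancel-⊑ {a = a} {b = b} (xa , xb , xo) (ya , yb , yo) X'⊑Y' x with x ≟ a | x ≟ b
... | yes refl | _        = subst₂ _≤_ xa ya (+-monoˡ-≤ 2 (X'⊑Y' x))
... | no _     | yes refl = s≤s⁻¹ (subst₂ _≤_ xb yb (X'⊑Y' x))
... | no x≢a   | no x≢b   = subst₂ _≤_ (xo x x≢a x≢b) (yo x x≢a x≢b) (X'⊑Y' x)

fire : (Fin n → ℕ) → Fin n → Fin n → Fin n → ℕ
fire X a b = updateAt₂ X a (_∸ 2) b suc

fire-Moves : a ≢ b → 2 ≤ X a → Moves X a b (fire X a b)
fire-Moves {X = X} a≢b 2≤ =
  trans (cong (_+ 2) (updateAt₂-first X _ _ a≢b)) (m∸n+n≡m 2≤) ,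
  updateAt₂-second X _ _ a≢b ,
  λ x → updateAt₂-other X _ _ a≢b

unfire : (Fin n → ℕ) → Fin n → Fin n → Fin n → ℕ
unfire X a b = updateAt₂ X a (_+ 2) b pred

unfire-Moves : a ≢ b → 1 ≤ X b → Moves (unfire X a b) a b X
unfire-Moves {b = b} {X = X} a≢b 1≤ =
  sym (updateAt₂-first X _ _ a≢b) ,
  trans (sym (suc-pred (X b) {{>-nonZero 1≤}})) (cong suc (sym (updateAt₂-second X _ _ a≢b))) ,
  λ x x≢a x≢b → sym (updateAt₂-other X _ _ a≢b x≢a x≢b)

⊑-before-Moves : Moves Y a b Y' → X ⊑ Y' → X b ≤ Y b → X ⊑ Y
⊑-before-Moves {a = a} {b = b} (ya , yb , yo) X⊑Y' Xb≤ x with x ≟ a | x ≟ b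
... | yes refl | _        = ≤-trans (X⊑Y' x) (subst (_ ≤_) ya (m≤m+n _ 2))
... | no _     | yes refl = Xb≤
... | no x≢a   | no x≢b   = subst (_ ≤_) (yo x x≢a x≢b) (X⊑Y' x)

weight : (Fin n → ℕ) → (Fin n → ℕ) → ℕ
weight w X = ∑ (λ x → X x * w x)

weight-mono-⊑ : ∀ (w : Fin n → ℕ) → X ⊑ Y → weight w X ≤ weight w Y
weight-mono-⊑ w X⊑Y = ∑-mono-≤ (λ x → *-monoˡ-≤ (w x) (X⊑Y x))

weight-pebblesAt : ∀ (w : Fin n → ℕ) a c → weight w (pebblesAt a c) ≡ c * w a
weight-pebblesAt w a c = trans (∑-cong pointwise) (∑-pebblesAt a (c * w a))
  where
  pointwise : ∀ x → pebblesAt a c x * w x ≡ pebblesAt a (c * w a) x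
  pointwise x with x ≟ a
  ... | yes refl = refl
  ... | no _     = refl

∑-≤-weight : ∀ (w : Fin n → ℕ) → (∀ x → 1 ≤ w x) → ∑ X ≤ weight w X
∑-≤-weight {X = X} w 1≤w =
  ∑-mono-≤ (λ x → subst (_≤ X x * w x) (*-identityʳ (X x)) (*-monoʳ-≤ (X x) (1≤w x)))

weight-Moves : ∀ (w : Fin n → ℕ) → a ≢ b → Moves X a b X' →
               weight w X' + 2 * w a ≡ weight w X + w b
weight-Moves {a = a} {b = b} {X = X} {X' = X'} w a≢b (xa , xb , xo) = begin
  weight w X' + 2 * w a
    ≡⟨ cong (weight w X' +_) (∑-pebblesAt a (2 * w a)) ⟨
  weight w X' + ∑ (pebblesAt a (2 * w a))
    ≡⟨ ∑-distrib-+ (λ x → X' x * w x) (pebblesAt a (2 * w a)) ⟨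
  ∑ (λ x → X' x * w x + pebblesAt a (2 * w a) x)
    ≡⟨ ∑-cong pointwise ⟩
  ∑ (λ x → X x * w x + pebblesAt b (w b) x)
    ≡⟨ ∑-distrib-+ (λ x → X x * w x) (pebblesAt b (w b)) ⟩
  weight w X + ∑ (pebblesAt b (w b))
    ≡⟨ cong (weight w X +_) (∑-pebblesAt b (w b)) ⟩
  weight w X + w b
    ∎
  where
  open ≡-Reasoning
  pointwise : ∀ x → X' x * w x + pebblesAt a (2 * w a) x ≡ X x * w x + pebblesAt b (w b) x
  pointwise x with x ≟ a | x ≟ b
  ... | yes refl | yes refl = ⊥-elim (a≢b refl)
  ... | yes refl | no _     = trans (sym (*-distribʳ-+ (w x) (X' x) 2))
                                    (trans (cong (_* w x) xa) (sym (+-identityʳ _)))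
  ... | no _     | yes refl =
    trans (+-identityʳ _) (trans (cong (_* w x) xb) (+-comm (w x) (X x * w x)))
  ... | no x≢a   | no x≢b   = cong (λ t → t * w x + 0) (xo x x≢a x≢b)

[1+m]∸n≤1+[m∸n] : ∀ m n → suc m ∸ n ≤ suc (m ∸ n)
[1+m]∸n≤1+[m∸n] m       zero    = ≤-refl
[1+m]∸n≤1+[m∸n] zero    (suc n) = ≤-trans (m∸n≤m 0 n) z≤n
[1+m]∸n≤1+[m∸n] (suc m) (suc n) = [1+m]∸n≤1+[m∸n] m n

module _ {P : ℕ → Set} where

  Least : ℕ → Set
  Least j = P j × (∀ i → P i → j ≤ i)

  Greatest : ℕ → Set
  Greatest m = P m × (∀ k → P k → k ≤ m)

  least : Decidable P → P k → ∃ Least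
  least {k} P? = search 0 k (λ _ ())
    where
    search : ∀ i fuel → (∀ j → j < i → ¬ P j) → P (i + fuel) → ∃ Least
    search i fuel none-below p with P? i
    ... | yes pᵢ = i , pᵢ , λ j pⱼ → ≮⇒≥ (λ j<i → none-below j j<i pⱼ)
    search i zero    none-below p | no ¬pᵢ = ⊥-elim (¬pᵢ (subst P (+-identityʳ i) p))
    search i (suc f) none-below p | no ¬pᵢ =
      search (suc i) f none-to-i (subst P (+-suc i f) p)
      where
      none-to-i : ∀ j → j < suc i → ¬ P j
      none-to-i j j<1+i with m<1+n⇒m<n∨m≡n j<1+i
      ... | inj₁ j<i  = none-below j j<i
      ... | inj₂ refl = ¬pᵢ

  ¬¬-greatest : ∀ bound → (∀ k → P k → k ≤ bound) → P k → ¬ ¬ ∃ Greatest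
  ¬¬-greatest zero        P≤0 pₖ ¬greatest =
    ¬greatest (_ , pₖ , λ j pⱼ → ≤-trans (P≤0 j pⱼ) z≤n)
  ¬¬-greatest (suc bound) P≤1+b pₖ ¬greatest = ¬¬-greatest bound P≤b pₖ ¬greatest
    where
    P≤b : ∀ j → P j → j ≤ bound
    P≤b j pⱼ with m<1+n⇒m<n∨m≡n (s≤s (P≤1+b j pⱼ))
    ... | inj₁ j<1+b = s≤s⁻¹ j<1+b
    ... | inj₂ refl  = ⊥-elim (¬greatest (_ , pⱼ , P≤1+b))

module _ (G : Graph) where

  private variable
    u v r : Vertex G
    D D' E : Distribution G

  adj⇒≢ : Adj G u v → u ≢ v
  adj⇒≢ {u} u~v refl = Graph.irrefl G u u~v

  fire-PStep : Adj G u v → 2 ≤ D u → PStep G D u v (fire D u v)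
  fire-PStep u~v 2≤ = u~v , 2≤ , fire-Moves (adj⇒≢ u~v) 2≤

  _◅◅_ : Reach G D D' → Reach G D' E → Reach G D E
  done         ◅◅ R' = R'
  move u v s R ◅◅ R' = move u v s (R ◅◅ R')

  Reach-solvable : Reach G D D' → Solvable G r D' → Solvable G r D
  Reach-solvable R (D'' , R' , solved) = D'' , R ◅◅ R' , solved

  transfer : Adj G u v → ∀ m → 2 * m ≤ D u → ∃[ D' ] Reach G D D' × m + D v ≤ D' v
  transfer {D = D} u~v zero 0≤ = D , done , ≤-refl
  transfer {u} {v} {D} u~v (suc m) 2[1+m]≤ = after-first-step (transfer u~v m 2m≤)
    where
    u≢v = adj⇒≢ u~v
    2+2m≤ : 2 + 2 * m ≤ D u
    2+2m≤ = subst (_≤ D u) (*-suc 2 m) 2[1+m]≤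
    2m≤ : 2 * m ≤ fire D u v u
    2m≤ = subst (2 * m ≤_) (sym (updateAt₂-first D _ _ u≢v)) (∸-monoˡ-≤ 2 2+2m≤)
    after-first-step : ∃[ D' ] Reach G (fire D u v) D' × m + fire D u v v ≤ D' v →
                       ∃[ D' ] Reach G D D' × suc m + D v ≤ D' v
    after-first-step (D' , R , m+≤) =
      D' , move u v (fire-PStep u~v (≤-trans (m≤m+n 2 (2 * m)) 2+2m≤)) R ,
      subst (_≤ D' v) (trans (cong (m +_) (updateAt₂-second D _ _ u≢v)) (+-suc m (D v))) m+≤

  walk-solvable : Walk G u r k → 2 ^ k ≤ D u → Solvable G r D
  walk-solvable {D = D} here 1≤ = D , done , 1≤
  walk-solvable {k = suc k} {D = D} (step {b = v} u~v walk) 2ᵏ⁺¹≤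
    with transfer u~v (2 ^ k) 2ᵏ⁺¹≤
  ... | D' , R , 2ᵏ+≤ = Reach-solvable R (walk-solvable walk (≤-trans (m≤m+n (2 ^ k) (D v)) 2ᵏ+≤))

  Sufficient : Vertex G → Distribution G → Set
  Sufficient r E = ∀ D → E ⊑ D → Solvable G r D

  walk-sufficient : Walk G u r k → Sufficient r (pebblesAt u (2 ^ k))
  walk-sufficient {u} {k = k} walk D 2ᵏ⊑D =
    walk-solvable walk (subst (_≤ D u) (pebblesAt-here u (2 ^ k)) (2ᵏ⊑D u))

  removeOne-pebblesAt : ∀ u c x → removeOne G (pebblesAt u c) u x ≡ pebblesAt u (c ∸ 1) x
  removeOne-pebblesAt u c x with does (x ≟ u)
  ... | true  = refl
  ... | false = refl

  ⊑-removeOne : E ⊑ D → E v < D v → E ⊑ removeOne G D v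
  ⊑-removeOne {v = v} E⊑D Ev<Dv x with x ≟ v
  ... | yes refl = ∸-monoˡ-≤ 1 Ev<Dv
  ... | no _     = E⊑D x

  critical-minimal : Critical G r D → E ⊑ D → Sufficient r E → D ⊑ E
  critical-minimal {D = D} {E = E} (_ , critical) E⊑D sufficient v with D v ≤? E v
  ... | yes Dv≤Ev = Dv≤Ev
  ... | no Dv≰Ev  = ⊥-elim (critical v (≤-trans (s≤s z≤n) Ev<Dv)
                                       (sufficient _ (⊑-removeOne E⊑D Ev<Dv)))
    where Ev<Dv = ≰⇒> Dv≰Ev

  walk? : ∀ k u v → Dec (Walk G u v k)
  walk? zero u v with u ≟ v
  ... | yes refl = yes here
  ... | no u≢v   = no λ { here → u≢v refl }
  walk? (suc k) u v with any? (λ w → T? (Graph.adj G u w) ×-dec walk? k w v)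
  ... | yes (w , u~w , walk) = yes (step u~w walk)
  ... | no ¬walk             = no λ { (step u~w walk) → ¬walk (_ , u~w , walk) }

module Distance (G : Graph) (connected : Connected G) where

  private variable
    u v r : Vertex G

  distance : ∀ u v → ∃ (Dist G u v)
  distance u v = least (λ j → walk? G j u v) (proj₂ (connected u v))

  dist : Vertex G → Vertex G → ℕ
  dist u v = proj₁ (distance u v)

  dist-Dist : ∀ u v → Dist G u v (dist u v)
  dist-Dist u v = proj₂ (distance u v)

  dist-minimal : ∀ u v → Walk G u v k → dist u v ≤ k
  dist-minimal u v walk = proj₂ (dist-Dist u v) _ walk

  Dist⇒≡dist : Dist G u v k → k ≡ dist u v
  Dist⇒≡dist {u} {v} (walk , minimal) =
    ≤-antisym (minimal _ (proj₁ (dist-Dist u v))) (dist-minimal u v walk)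

  dist-refl : ∀ r → dist r r ≡ 0
  dist-refl r = n≤0⇒n≡0 (dist-minimal r r here)

  dist-adj : Adj G u v → dist u r ≤ suc (dist v r)
  dist-adj {u} {v} {r} u~v = dist-minimal u r (step u~v (proj₁ (dist-Dist v r)))

module PebbleWeight (G : Graph) (connected : Connected G) (d : ℕ)
                    (Dist≤d : ∀ u v k → Dist G u v k → k ≤ d) where
  open Distance G connected

  private variable
    u v r : Vertex G
    D D' E' : Distribution G

  dist≤d : ∀ u v → dist u v ≤ d
  dist≤d u v = Dist≤d u v _ (dist-Dist u v)

  -- The classical weight 2^(-dist(x,r)) scaled by 2^d to stay in ℕ.
  pebbleWeight : Vertex G → Vertex G → ℕ
  pebbleWeight r x = 2 ^ (d ∸ dist x r)

  W : Vertex G → Distribution G → ℕ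
  W r = weight (pebbleWeight r)

  W-root-pebble : ∀ r → W r (pebblesAt r 1) ≡ 2 ^ d
  W-root-pebble r = trans (weight-pebblesAt _ r 1)
                          (trans (*-identityˡ _) (cong (λ j → 2 ^ (d ∸ j)) (dist-refl r)))

  pebbleWeight-adj : Adj G u v → pebbleWeight r v ≤ 2 * pebbleWeight r u
  pebbleWeight-adj {u} {v} {r} u~v =
    ^-monoʳ-≤ 2 (≤-trans (∸-monoʳ-≤ (suc d) (dist-adj u~v)) ([1+m]∸n≤1+[m∸n] d (dist u r)))

  pebbleWeight-greedy : GreedyPair G r u v → 2 * pebbleWeight r u ≤ pebbleWeight r v
  pebbleWeight-greedy {r} {u} (_ , _ , u-r , v-r , kᵥ<kᵤ) =
    ^-monoʳ-≤ 2 (∸-monoʳ-< (subst₂ _<_ (Dist⇒≡dist v-r) (Dist⇒≡dist u-r) kᵥ<kᵤ) (dist≤d u r))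

  W-PStep : PStep G D u v D' → W r D' ≤ W r D
  W-PStep {D} {u} {r = r} (u~v , _ , moves) =
    +-cancelʳ-≤ (2 * pebbleWeight r u) _ _
      (≤-trans (≤-reflexive (weight-Moves _ (adj⇒≢ G u~v) moves))
               (+-monoʳ-≤ (W r D) (pebbleWeight-adj u~v)))

  W-Reach : Reach G D D' → W r D' ≤ W r D
  W-Reach done           = ≤-refl
  W-Reach (move _ _ s R) = ≤-trans (W-Reach R) (W-PStep s)

  W-solvable : Solvable G r D → 2 ^ d ≤ W r D
  W-solvable {r} (D' , R , 1≤D'r) =
    ≤-trans (≤-reflexive (sym (W-root-pebble r)))
            (≤-trans (weight-mono-⊑ _ (pebblesAt-⊑ {X = D'} r 1≤D'r)) (W-Reach R))

  far-pebbles-critical : Dist G u r d → Critical G r (pebblesAt u (2 ^ d))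
  far-pebbles-critical {u} {r} u-r = walk-sufficient G (proj₁ u-r) _ (λ _ → ≤-refl) , unsolvable
    where
    pebbleWeight-far : pebbleWeight r u ≡ 1
    pebbleWeight-far =
      trans (cong (λ j → 2 ^ (d ∸ j)) (sym (Dist⇒≡dist u-r))) (cong (2 ^_) (n∸n≡0 d))

    W-removeOne : W r (removeOne G (pebblesAt u (2 ^ d)) u) ≡ 2 ^ d ∸ 1
    W-removeOne = begin
      W r (removeOne G (pebblesAt u (2 ^ d)) u)
        ≡⟨ ∑-cong (λ x → cong (_* pebbleWeight r x) (removeOne-pebblesAt G u (2 ^ d) x)) ⟩
      W r (pebblesAt u (2 ^ d ∸ 1))
        ≡⟨ weight-pebblesAt _ u _ ⟩
      (2 ^ d ∸ 1) * pebbleWeight r u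
        ≡⟨ cong ((2 ^ d ∸ 1) *_) pebbleWeight-far ⟩
      (2 ^ d ∸ 1) * 1
        ≡⟨ *-identityʳ _ ⟩
      2 ^ d ∸ 1
        ∎
      where open ≡-Reasoning

    unsolvable : ∀ v → 1 ≤ pebblesAt u (2 ^ d) v →
                 ¬ Solvable G r (removeOne G (pebblesAt u (2 ^ d)) v)
    unsolvable v 1≤ solvable with pebblesAt-support u _ v 1≤
    ... | refl = ≤⇒≯ (subst (2 ^ d ≤_) W-removeOne (W-solvable solvable))
                     (∸-monoʳ-< (s≤s z≤n) (m^n>0 2 d))

  sufficient-before-greedy-step : GreedyPair G r u v → PStep G D u v D' → E' ⊑ D' →
    Sufficient G r E' → ∃[ E ] E ⊑ D × Sufficient G r E × W r E ≤ W r E'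
  sufficient-before-greedy-step {r} {u} {v} {D} {E' = E'}
                                greedy (u~v , _ , D-moves) E'⊑D' sufficient with E' v ≤? D v
  ... | yes E'v≤Dv = E' , ⊑-before-Moves D-moves E'⊑D' E'v≤Dv , sufficient , ≤-refl
  -- E' needs the pebble the step put on v, so the step is undone on E'.
  ... | no E'v≰Dv  = unfire E' u v , Moves-cancel-⊑ E-moves D-moves E'⊑D' , E-sufficient , W-E≤
    where
    u≢v   = adj⇒≢ G u~v
    E-moves : Moves (unfire E' u v) u v E'
    E-moves = unfire-Moves u≢v (≤-trans (s≤s z≤n) (≰⇒> E'v≰Dv))

    E-sufficient : Sufficient G r (unfire E' u v)
    E-sufficient X E⊑X = Reach-solvable G (move u v (fire-PStep G u~v 2≤Xu) done)
      (sufficient (fire X u v) (Moves-mono-⊑ E-moves (fire-Moves u≢v 2≤Xu) E⊑X))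
      where
      2≤Xu : 2 ≤ X u
      2≤Xu = ≤-trans (subst (2 ≤_) (proj₁ E-moves) (m≤n+m 2 _)) (E⊑X u)

    W-E≤ : W r (unfire E' u v) ≤ W r E'
    W-E≤ = +-cancelʳ-≤ (pebbleWeight r v) _ _
      (≤-trans (≤-reflexive (sym (weight-Moves _ u≢v E-moves)))
               (+-monoʳ-≤ (W r E') (pebbleWeight-greedy greedy)))

  sufficient-before-greedy-solution : GReach G r D D' → E' ⊑ D' → Sufficient G r E' →
    ∃[ E ] E ⊑ D × Sufficient G r E × W r E ≤ W r E'
  sufficient-before-greedy-solution {E' = E'} done E'⊑D' sufficient =
    E' , E'⊑D' , sufficient , ≤-refl
  sufficient-before-greedy-solution (move u v greedy s R) E'⊑D' sufficient
    with sufficient-before-greedy-solution R E'⊑D' sufficient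
  ... | E₁ , E₁⊑ , E₁-sufficient , W-E₁≤
    with sufficient-before-greedy-step greedy s E₁⊑ E₁-sufficient
  ...   | E , E⊑D , E-sufficient , W-E≤ = E , E⊑D , E-sufficient , ≤-trans W-E≤ W-E₁≤

  greedy-critical-size-≤ : Critical G r D → Greedy G r D → size G D ≤ 2 ^ d
  greedy-critical-size-≤ {r} {D} critical (D' , R , 1≤D'r)
    with sufficient-before-greedy-solution R (pebblesAt-⊑ {X = D'} r 1≤D'r) (walk-sufficient G here)
  ... | E , E⊑D , E-sufficient , W-E≤ = begin
    ∑ D                   ≤⟨ ∑-mono-≤ (critical-minimal G critical E⊑D E-sufficient) ⟩
    ∑ E                   ≤⟨ ∑-≤-weight _ (λ x → m^n>0 2 (d ∸ dist x r)) ⟩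
    W r E                 ≤⟨ W-E≤ ⟩
    W r (pebblesAt r 1)   ≡⟨ W-root-pebble r ⟩
    2 ^ d                 ∎
    where open ≤-Reasoning

  critical-pebbles-≤ : Critical G r D → ∀ v → D v ≤ 2 ^ d
  critical-pebbles-≤ {r} {D} critical v with 2 ^ dist v r ≤? D v
  ... | yes 2ᵏ≤Dv = begin
    D v                        ≤⟨ critical-minimal G critical (pebblesAt-⊑ v 2ᵏ≤Dv) sufficient v ⟩
    pebblesAt v (2 ^ dist v r) v ≡⟨ pebblesAt-here v _ ⟩
    2 ^ dist v r               ≤⟨ ^-monoʳ-≤ 2 (dist≤d v r) ⟩
    2 ^ d                      ∎
    where
    open ≤-Reasoning
    sufficient = walk-sufficient G (proj₁ (dist-Dist v r))
  ... | no 2ᵏ≰Dv  = ≤-trans (<⇒≤ (≰⇒> 2ᵏ≰Dv)) (^-monoʳ-≤ 2 (dist≤d v r))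

theorem15 : (G : Graph) (d : ℕ) → Thrifty G → Connected G → Diameter G d
          → IsCr G (2 ^ d)
theorem15 G d thrifty connected ((u , r , u-r) , Dist≤d) = far , critical-size-≤
  where
  open PebbleWeight G connected d Dist≤d

  CriticalSize : ℕ → Set
  CriticalSize m = ∃[ r ] ∃[ D ] Critical G r D × size G D ≡ m

  far : CriticalSize (2 ^ d)
  far = r , pebblesAt u (2 ^ d) , far-pebbles-critical u-r , ∑-pebblesAt u (2 ^ d)

  ceiling-≤ : ∀ {m} → Greatest {CriticalSize} m → m ≤ 2 ^ d
  ceiling-≤ (ceiling@(r , D , critical , refl) , maximal) =
    greedy-critical-size-≤ critical
      (thrifty _ (ceiling , λ r D c → maximal _ (r , D , c , refl)) r D critical refl)

  -- Criticality is not decidable, so c_r(G) is only obtained under a double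
  -- negation; that suffices because the goal is decidable.
  critical-size-≤ : ∀ r D → Critical G r D → size G D ≤ 2 ^ d
  critical-size-≤ r D critical = decidable-stable (size G D ≤? 2 ^ d) λ size≰ →
    ¬¬-greatest (∑ {Graph.n G} (λ _ → 2 ^ d))
      (λ { _ (_ , _ , c , refl) → ∑-mono-≤ (critical-pebbles-≤ c) })
      far
      λ (_ , greatest) →
        size≰ (≤-trans (proj₂ greatest _ (r , D , critical , refl)) (ceiling-≤ greatest))
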